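{- Let $G$ be a finite group with $G=\langle x,y\rangle$, where $|x|=3$ and $|y|\geq 4$. Then $\mathrm{Cay}(G,\{x,y\})$ is an oriented regular representation of $G$, unless $|y|=6$, $x=y^4$, and $G\cong\mathbb{Z}_6$.
   Context: $|g|$ denotes the order of $g$. A digraph consists of a vertex set and a set of arcs (ordered pairs of vertices); its automorphisms are the vertex permutations preserving the arcs. A digraph is proper if whenever $(u,v)$ is an arc, $(v,u)$ is not. For $S\subseteq G$, the Cayley digraph $\mathrm{Cay}(G,S)$ has vertex set $G$ and $(u,v)$ is an arc whenever $vu^{ -1}\in S$. Its automorphism group contains the right regular representation of $G$; if equality holds it is a digraphical regular representation (DRR), and a DRR which is a proper digraph is an oriented regular representation (ORR). -}

module Defs where

open import Level using (Level; _⊔_)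
open import Data.Nat as ℕ using (ℕ; zero; suc)
open import Data.Nat.DivMod using (_mod_)
open import Data.Fin using (Fin; toℕ)
open import Data.Product using (Σ; ∃; _×_; _,_; proj₁)
open import Data.Sum using (_⊎_)
open import Relation.Nullary using (¬_)
open import Relation.Binary.PropositionalEquality as ≡ using (_≡_)
open import Function.Bundles using (Inverse)
open import Algebra.Bundles using (Group)

_⊕₆_ : Fin 6 → Fin 6 → Fin 6
a ⊕₆ b = (toℕ a ℕ.+ toℕ b) mod 6

module GroupDefs {c ℓ : Level} (G : Group c ℓ) where
  open Group G

  _^_ : Carrier → ℕ → Carrier
  g ^ zero  = ε
  g ^ suc n = g ∙ (g ^ n)

  HasOrder : Carrier → ℕ → Set ℓ
  HasOrder g k = (0 ℕ.< k) × (g ^ k ≈ ε) × (∀ j → 0 ℕ.< j → j ℕ.< k → ¬ (g ^ j ≈ ε))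

  Finite : Set (c ⊔ ℓ)
  Finite = Σ ℕ λ n → Inverse setoid (≡.setoid (Fin n))

  data Word : Set where
    e    : Word
    genX : Word
    genY : Word
    _·_  : Word → Word → Word
    inv  : Word → Word

  eval : Carrier → Carrier → Word → Carrier
  eval x y e       = ε
  eval x y genX    = x
  eval x y genY    = y
  eval x y (w · v) = eval x y w ∙ eval x y v
  eval x y (inv w) = (eval x y w) ⁻¹

  GeneratedBy : Carrier → Carrier → Set (c ⊔ ℓ)
  GeneratedBy x y = ∀ g → ∃ λ w → eval x y w ≈ g

  -- Cayley digraph Cay(G,S): arc (u,v) iff v u⁻¹ ∈ S
  Arc : (Carrier → Set ℓ) → Carrier → Carrier → Set ℓ
  Arc S u v = S (v ∙ u ⁻¹)

  Pair : Carrier → Carrier → Carrier → Set ℓ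
  Pair x y s = (s ≈ x) ⊎ (s ≈ y)

  Automorphism : (Carrier → Set ℓ) → Set (c ⊔ ℓ)
  Automorphism S = Σ (Inverse setoid setoid) λ σ →
    ∀ u v → (Arc S u v → Arc S (Inverse.to σ u) (Inverse.to σ v))
          × (Arc S (Inverse.to σ u) (Inverse.to σ v) → Arc S u v)

  -- DRR: every automorphism lies in the right regular representation
  IsDRR : (Carrier → Set ℓ) → Set (c ⊔ ℓ)
  IsDRR S = (σ : Automorphism S) →
    ∃ λ g → ∀ u → Inverse.to (proj₁ σ) u ≈ u ∙ g

  IsProper : (Carrier → Set ℓ) → Set (c ⊔ ℓ)
  IsProper S = ∀ u v → Arc S u v → ¬ Arc S v u

  IsORR : (Carrier → Set ℓ) → Set (c ⊔ ℓ)
  IsORR S = IsDRR S × IsProper S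

  IsoZ6 : Set (c ⊔ ℓ)
  IsoZ6 = Σ (Inverse setoid (≡.setoid (Fin 6))) λ f →
    ∀ a b → Inverse.to f (a ∙ b) ≡ Inverse.to f a ⊕₆ Inverse.to f b

-- An x-arc (u, xu) of Cay(G,{x,y}) lies on the directed triangle u → xu → x²u → u.  A y-arc
-- lies on no directed triangle: such a triangle would give a relation of length 3 starting with
-- y, and each of them (x²y, yxy, xy², y³) contradicts |x| = 3, |y| ≥ 4, except xy² = 1, which
-- forces x = y⁴, |y| = 6 and G = ⟨y⟩ ≅ ℤ₆.  So every automorphism, together with its inverse,
-- maps x-arcs to x-arcs, hence also y-arcs to y-arcs; it then commutes with left
-- multiplication by the generators and is a right translation.  Properness is the absence of
-- relations of length 2.

module Submission where

open import Defs
open import Level using (Level)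
open import Data.Nat using (ℕ; zero; suc; _+_; _*_; _∸_; _≤_; _<_; _≥_; z≤n; s≤s; NonZero; >-nonZero)
open import Data.Nat.Properties
  using (*-suc; *-zeroʳ; m+[n∸m]≡n; m∸n≤m; m∸n≡0⇒m≤n; ≤-antisym; ≤-total; ≤-trans; ≤-<-trans)
open import Data.Nat.DivMod using (_mod_; _%_; _/_; m≡m%n+[m/n]*n; m%n<n)
open import Data.Nat.Divisibility using (_∣_; ∣⇒≤; m%n≡0⇒n∣m; n∣m⇒m%n≡0)
open import Data.Fin using (Fin; toℕ)
open import Data.Fin.Properties using (toℕ-injective; toℕ<n; toℕ-fromℕ<)
open import Data.Product using (Σ; ∃; _×_; _,_; proj₁; proj₂)
open import Data.Sum using (_⊎_; inj₁; inj₂)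
open import Data.Empty using (⊥; ⊥-elim)
open import Relation.Nullary using (¬_; contradiction)
open import Relation.Binary.PropositionalEquality as ≡ using (_≡_)
open import Function.Base using (_∘_)
open import Function.Bundles using (Inverse)
import Function.Construct.Symmetry as Symmetry
open import Algebra.Bundles using (Group)
import Algebra.Properties.Group as GroupProperties
import Relation.Binary.Reasoning.Setoid as SetoidReasoning

∣6⇒≡6 : ∀ {k} → 4 ≤ k → k ∣ 6 → k ≡ 6
∣6⇒≡6 {0} () _
∣6⇒≡6 {1} (s≤s ()) _
∣6⇒≡6 {2} (s≤s (s≤s ())) _
∣6⇒≡6 {3} (s≤s (s≤s (s≤s ()))) _
∣6⇒≡6 {4} _ 4∣6 with () ← n∣m⇒m%n≡0 6 4 4∣6
∣6⇒≡6 {5} _ 5∣6 with () ← n∣m⇒m%n≡0 6 5 5∣6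
∣6⇒≡6 {6} _ _ = ≡.refl
∣6⇒≡6 {suc (suc (suc (suc (suc (suc (suc _))))))} _ k∣6 =
  contradiction (∣⇒≤ k∣6) λ { (s≤s (s≤s (s≤s (s≤s (s≤s (s≤s ())))))) }

module GroupLemmas {c ℓ : Level} (G : Group c ℓ) where
  open Group G
  open GroupDefs G
  open GroupProperties G
  open SetoidReasoning setoid

  ∙≈ε-comm : ∀ {a b} → a ∙ b ≈ ε → b ∙ a ≈ ε
  ∙≈ε-comm {a} {b} ab≈ε = trans (∙-congˡ (inverseˡ-unique a b ab≈ε)) (inverseʳ b)

  ∙≈ε-cancel : ∀ {a b} c → a ∙ b ≈ ε → a ∙ (b ∙ c) ≈ c
  ∙≈ε-cancel c ab≈ε = trans (sym (assoc _ _ _)) (trans (∙-congʳ ab≈ε) (identityˡ c))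

  ^-congˡ : ∀ {g h} → g ≈ h → ∀ n → g ^ n ≈ h ^ n
  ^-congˡ g≈h zero    = refl
  ^-congˡ g≈h (suc n) = ∙-cong g≈h (^-congˡ g≈h n)

  ^-homo-+ : ∀ g m n → g ^ (m + n) ≈ g ^ m ∙ g ^ n
  ^-homo-+ g zero    n = sym (identityˡ _)
  ^-homo-+ g (suc m) n = trans (∙-congˡ (^-homo-+ g m n)) (sym (assoc _ _ _))

  ^-assoc : ∀ g m n → (g ^ m) ^ n ≈ g ^ (m * n)
  ^-assoc g m zero    = reflexive (≡.cong (g ^_) (≡.sym (*-zeroʳ m)))
  ^-assoc g m (suc n) = begin
    g ^ m ∙ (g ^ m) ^ n   ≈⟨ ∙-congˡ (^-assoc g m n) ⟩
    g ^ m ∙ g ^ (m * n)   ≈⟨ ^-homo-+ g m (m * n) ⟨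
    g ^ (m + m * n)       ≡⟨ ≡.cong (g ^_) (*-suc m n) ⟨
    g ^ (m * suc n)       ∎

  ^-*-ε : ∀ {g n} → g ^ n ≈ ε → ∀ q → g ^ (q * n) ≈ ε
  ^-*-ε g^n≈ε zero            = refl
  ^-*-ε {g} {n} g^n≈ε (suc q) = begin
    g ^ (n + q * n)       ≈⟨ ^-homo-+ g n (q * n) ⟩
    g ^ n ∙ g ^ (q * n)   ≈⟨ ∙-cong g^n≈ε (^-*-ε g^n≈ε q) ⟩
    ε ∙ ε                 ≈⟨ identityˡ ε ⟩
    ε                     ∎

  ^-% : ∀ {g} n .{{_ : NonZero n}} → g ^ n ≈ ε → ∀ m → g ^ m ≈ g ^ (m % n)
  ^-% {g} n g^n≈ε m = begin
    g ^ m                           ≡⟨ ≡.cong (g ^_) (m≡m%n+[m/n]*n m n) ⟩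
    g ^ (m % n + m / n * n)         ≈⟨ ^-homo-+ g (m % n) _ ⟩
    g ^ (m % n) ∙ g ^ (m / n * n)   ≈⟨ ∙-congˡ (^-*-ε g^n≈ε (m / n)) ⟩
    g ^ (m % n) ∙ ε                 ≈⟨ identityʳ _ ⟩
    g ^ (m % n)                     ∎

  ^-⁻¹ : ∀ {g m} → g ^ suc m ≈ ε → ∀ i → (g ^ i) ⁻¹ ≈ g ^ (i * m)
  ^-⁻¹ {g} {m} g^n≈ε i = sym (inverseʳ-unique (g ^ i) (g ^ (i * m)) (begin
    g ^ i ∙ g ^ (i * m)   ≈⟨ ^-homo-+ g i (i * m) ⟨
    g ^ (i + i * m)       ≡⟨ ≡.cong (g ^_) (*-suc i m) ⟨
    g ^ (i * suc m)       ≈⟨ ^-*-ε g^n≈ε i ⟩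
    ε                     ∎))

  ^-gap : ∀ {g i j} → i ≤ j → g ^ i ≈ g ^ j → g ^ (j ∸ i) ≈ ε
  ^-gap {g} {i} {j} i≤j g^i≈g^j = sym (∙-cancelˡ (g ^ i) ε (g ^ (j ∸ i)) (begin
    g ^ i ∙ ε               ≈⟨ identityʳ _ ⟩
    g ^ i                   ≈⟨ g^i≈g^j ⟩
    g ^ j                   ≡⟨ ≡.cong (g ^_) (m+[n∸m]≡n i≤j) ⟨
    g ^ (i + (j ∸ i))       ≈⟨ ^-homo-+ g i (j ∸ i) ⟩
    g ^ i ∙ g ^ (j ∸ i)     ∎))

  ^≈ε-below-order : ∀ {g k j} → HasOrder g k → j < k → g ^ j ≈ ε → j ≡ 0
  ^≈ε-below-order {j = zero}  _                 _   _     = ≡.refl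
  ^≈ε-below-order {j = suc j} (_ , _ , minimal) j<k g^j≈ε =
    ⊥-elim (minimal (suc j) (s≤s z≤n) j<k g^j≈ε)

  order-divides : ∀ {g k n} → HasOrder g k → g ^ n ≈ ε → k ∣ n
  order-divides {g} {k} {n} o@(0<k , g^k≈ε , _) g^n≈ε =
    m%n≡0⇒n∣m n k (^≈ε-below-order o (m%n<n n k) (trans (sym (^-% k g^k≈ε n)) g^n≈ε))
    where instance
      k≢0 : NonZero k
      k≢0 = >-nonZero 0<k

  ^-injective : ∀ {g k i j} → HasOrder g k → i < k → j < k → g ^ i ≈ g ^ j → i ≡ j
  ^-injective {i = i} {j} o i<k j<k g^i≈g^j with ≤-total i j
  ... | inj₁ i≤j = ≤-antisym i≤j
        (m∸n≡0⇒m≤n (^≈ε-below-order o (≤-<-trans (m∸n≤m j i) j<k) (^-gap i≤j g^i≈g^j)))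
  ... | inj₂ j≤i = ≡.sym (≤-antisym j≤i
        (m∸n≡0⇒m≤n (^≈ε-below-order o (≤-<-trans (m∸n≤m i j) i<k) (^-gap j≤i (sym g^i≈g^j)))))

  cyclic≅Fin : ∀ {g m} → HasOrder g (suc m) → (∀ h → ∃ λ i → h ≈ g ^ i) →
    Σ (Inverse setoid (≡.setoid (Fin (suc m)))) λ f →
      ∀ a b → Inverse.to f (a ∙ b) ≡ (toℕ (Inverse.to f a) + toℕ (Inverse.to f b)) mod suc m
  cyclic≅Fin {g} {m} o@(_ , g^n≈ε , _) powers = iso , homo
    where
    index : Carrier → Fin (suc m)
    index h = proj₁ (powers h) mod suc m

    ^-mod : ∀ i → g ^ i ≈ g ^ toℕ (i mod suc m)
    ^-mod i = trans (^-% (suc m) g^n≈ε i)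
                    (reflexive (≡.cong (g ^_) (≡.sym (toℕ-fromℕ< (m%n<n i (suc m))))))

    ^-index : ∀ h → h ≈ g ^ toℕ (index h)
    ^-index h = trans (proj₂ (powers h)) (^-mod (proj₁ (powers h)))

    ^-toℕ-injective : ∀ {a b : Fin (suc m)} → g ^ toℕ a ≈ g ^ toℕ b → a ≡ b
    ^-toℕ-injective eq = toℕ-injective (^-injective o (toℕ<n _) (toℕ<n _) eq)

    iso : Inverse setoid (≡.setoid (Fin (suc m)))
    iso = record
      { to        = index
      ; from      = λ a → g ^ toℕ a
      ; to-cong   = λ {h} {h′} h≈h′ →
          ^-toℕ-injective (trans (sym (^-index h)) (trans h≈h′ (^-index h′)))
      ; from-cong = λ { ≡.refl → refl }
      ; inverse   = (λ {_} {h} h≈gᵃ → ^-toℕ-injective (trans (sym (^-index h)) h≈gᵃ))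
                  , λ { {h} ≡.refl → sym (^-index h) }
      }

    homo : ∀ a b → index (a ∙ b) ≡ (toℕ (index a) + toℕ (index b)) mod suc m
    homo a b = ^-toℕ-injective (begin
      g ^ toℕ (index (a ∙ b))                 ≈⟨ ^-index (a ∙ b) ⟨
      a ∙ b                                   ≈⟨ ∙-cong (^-index a) (^-index b) ⟩
      g ^ toℕ (index a) ∙ g ^ toℕ (index b)   ≈⟨ ^-homo-+ g (toℕ (index a)) (toℕ (index b)) ⟨
      g ^ (toℕ (index a) + toℕ (index b))     ≈⟨ ^-mod (toℕ (index a) + toℕ (index b)) ⟩
      g ^ toℕ ((toℕ (index a) + toℕ (index b)) mod suc m) ∎)

  module _ {x y g : Carrier} {m a b : ℕ}
           (g^n≈ε : g ^ suc m ≈ ε) (x≈gᵃ : x ≈ g ^ a) (y≈gᵇ : y ≈ g ^ b) where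

    eval-power : ∀ w → ∃ λ i → eval x y w ≈ g ^ i
    eval-power e       = 0 , refl
    eval-power genX    = a , x≈gᵃ
    eval-power genY    = b , y≈gᵇ
    eval-power (w · v) with eval-power w | eval-power v
    ... | i , w≈gⁱ | j , v≈gʲ = i + j , trans (∙-cong w≈gⁱ v≈gʲ) (sym (^-homo-+ g i j))
    eval-power (inv w) with eval-power w
    ... | i , w≈gⁱ = i * m , trans (⁻¹-cong w≈gⁱ) (^-⁻¹ g^n≈ε i)

  equivariant⇒translation : ∀ {x y} → GeneratedBy x y → (f : Carrier → Carrier) →
    (∀ {u v} → u ≈ v → f u ≈ f v) →
    (∀ u → f (x ∙ u) ≈ x ∙ f u) → (∀ u → f (y ∙ u) ≈ y ∙ f u) →
    ∀ u → f u ≈ u ∙ f ε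
  equivariant⇒translation {x} {y} gen f f-cong f-x f-y u = begin
    f u                  ≈⟨ f-cong (trans (sym w≈u) (sym (identityʳ _))) ⟩
    f (eval x y w ∙ ε)   ≈⟨ eval-commutes w ε ⟩
    eval x y w ∙ f ε     ≈⟨ ∙-congʳ w≈u ⟩
    u ∙ f ε              ∎
    where
    w : Word
    w = proj₁ (gen u)

    w≈u : eval x y w ≈ u
    w≈u = proj₂ (gen u)

    eval-commutes : ∀ w u → f (eval x y w ∙ u) ≈ eval x y w ∙ f u
    eval-commutes e       u = trans (f-cong (identityˡ u)) (sym (identityˡ _))
    eval-commutes genX    u = f-x u
    eval-commutes genY    u = f-y u
    eval-commutes (w · v) u = begin
      f ((W ∙ V) ∙ u)   ≈⟨ f-cong (assoc _ _ _) ⟩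
      f (W ∙ (V ∙ u))   ≈⟨ eval-commutes w _ ⟩
      W ∙ f (V ∙ u)     ≈⟨ ∙-congˡ (eval-commutes v u) ⟩
      W ∙ (V ∙ f u)     ≈⟨ assoc _ _ _ ⟨
      (W ∙ V) ∙ f u     ∎
      where
      W V : Carrier
      W = eval x y w
      V = eval x y v
    eval-commutes (inv w) u = begin
      f (W ⁻¹ ∙ u)                 ≈⟨ ∙≈ε-cancel _ (inverseˡ W) ⟨
      W ⁻¹ ∙ (W ∙ f (W ⁻¹ ∙ u))    ≈⟨ ∙-congˡ (eval-commutes w _) ⟨
      W ⁻¹ ∙ f (W ∙ (W ⁻¹ ∙ u))    ≈⟨ ∙-congˡ (f-cong (∙≈ε-cancel u (inverseʳ W))) ⟩
      W ⁻¹ ∙ f u                   ∎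
      where
      W : Carrier
      W = eval x y w

  relation-of-2-cycle : ∀ {u v s t} → v ≈ s ∙ u → u ≈ t ∙ v → t ∙ s ≈ ε
  relation-of-2-cycle {u} v≈su u≈tv =
    identityˡ-unique _ u (sym (trans u≈tv (trans (∙-congˡ v≈su) (sym (assoc _ _ _)))))

  relation-of-3-cycle : ∀ {u v w s₁ s₂ s₃} → v ≈ s₁ ∙ u → w ≈ s₂ ∙ v → u ≈ s₃ ∙ w → s₃ ∙ (s₂ ∙ s₁) ≈ ε
  relation-of-3-cycle {u} {v} {w} {s₁} {s₂} {s₃} v≈ w≈ u≈ = identityˡ-unique _ u (sym (begin
    u                      ≈⟨ u≈ ⟩
    s₃ ∙ w                 ≈⟨ ∙-congˡ w≈ ⟩
    s₃ ∙ (s₂ ∙ v)          ≈⟨ ∙-congˡ (∙-congˡ v≈) ⟩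
    s₃ ∙ (s₂ ∙ (s₁ ∙ u))   ≈⟨ ∙-congˡ (assoc _ _ _) ⟨
    s₃ ∙ ((s₂ ∙ s₁) ∙ u)   ≈⟨ assoc _ _ _ ⟨
    s₃ ∙ (s₂ ∙ s₁) ∙ u     ∎))

  module _ {S : Carrier → Set ℓ} (S-resp : ∀ {s t} → s ≈ t → S s → S t) where

    Arc-resp : ∀ {u u′ v v′} → u ≈ u′ → v ≈ v′ → Arc S u v → Arc S u′ v′
    Arc-resp u≈ v≈ = S-resp (∙-cong v≈ (⁻¹-cong u≈))

    Automorphism-sym : Automorphism S → Automorphism S
    Automorphism-sym (σ , preserves) = Symmetry.inverse σ , λ u v →
      (λ arc → proj₂ (preserves _ _) (Arc-resp (sym (to∘from u)) (sym (to∘from v)) arc)) ,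
      (λ arc → Arc-resp (to∘from u) (to∘from v) (proj₁ (preserves _ _) arc))
      where
      to∘from : ∀ w → Inverse.to σ (Inverse.from σ w) ≈ w
      to∘from = Inverse.strictlyInverseˡ σ

  module CayleyPair (x y : Carrier) where
    S : Carrier → Set ℓ
    S = Pair x y

    S-resp : ∀ {s t} → s ≈ t → S s → S t
    S-resp s≈t (inj₁ s≈x) = inj₁ (trans (sym s≈t) s≈x)
    S-resp s≈t (inj₂ s≈y) = inj₂ (trans (sym s≈t) s≈y)

    x-arc : ∀ u → Arc S u (x ∙ u)
    x-arc u = inj₁ (//-rightDividesʳ u x)

    y-arc : ∀ u → Arc S u (y ∙ u)
    y-arc u = inj₂ (//-rightDividesʳ u y)

    arc-cases : ∀ {u v} → Arc S u v → (v ≈ x ∙ u) ⊎ (v ≈ y ∙ u)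
    arc-cases {u} {v} (inj₁ v/u≈x) = inj₁ (trans (sym (//-rightDividesˡ u v)) (∙-congʳ v/u≈x))
    arc-cases {u} {v} (inj₂ v/u≈y) = inj₂ (trans (sym (//-rightDividesˡ u v)) (∙-congʳ v/u≈y))

  module Generators (x y : Carrier) {k : ℕ}
                    (ord-x : HasOrder x 3) (ord-y : HasOrder y k) (k≥4 : k ≥ 4) where
    x³≈ε : x ^ 3 ≈ ε
    x³≈ε = proj₁ (proj₂ ord-x)

    x²≈x⁻¹ : x ^ 2 ≈ x ⁻¹
    x²≈x⁻¹ = inverseʳ-unique x (x ^ 2) x³≈ε

    x∙[x∙[x∙u]]≈u : ∀ u → x ∙ (x ∙ (x ∙ u)) ≈ u
    x∙[x∙[x∙u]]≈u u = trans (∙-congˡ (sym (assoc x x u)))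
      (∙≈ε-cancel u (trans (∙-congˡ (∙-congˡ (sym (identityʳ x)))) x³≈ε))

    y^j≉ε : ∀ j → 0 < j → j < 4 → ¬ (y ^ j ≈ ε)
    y^j≉ε j 0<j j<4 = proj₂ (proj₂ ord-y) j 0<j (≤-trans j<4 k≥4)

    y≉x : ¬ (y ≈ x)
    y≉x y≈x = y^j≉ε 3 (s≤s z≤n) (s≤s (s≤s (s≤s (s≤s z≤n)))) (trans (^-congˡ y≈x 3) x³≈ε)

    xx≉ε : ¬ (x ∙ x ≈ ε)
    xx≉ε xx≈ε = proj₂ (proj₂ ord-x) 2 (s≤s z≤n) (s≤s (s≤s (s≤s z≤n)))
      (trans (∙-congˡ (identityʳ x)) xx≈ε)

    yy≉ε : ¬ (y ∙ y ≈ ε)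
    yy≉ε yy≈ε = y^j≉ε 2 (s≤s z≤n) (s≤s (s≤s (s≤s z≤n))) (trans (∙-congˡ (identityʳ y)) yy≈ε)

    yyy≉ε : ¬ (y ∙ (y ∙ y) ≈ ε)
    yyy≉ε yyy≈ε = y^j≉ε 3 (s≤s z≤n) (s≤s (s≤s (s≤s (s≤s z≤n))))
      (trans (∙-congˡ (∙-congˡ (identityʳ y))) yyy≈ε)

    -- yx = 1 makes y = x⁻¹ = x², so y³ = x⁶ = 1.
    yx≉ε : ¬ (y ∙ x ≈ ε)
    yx≉ε yx≈ε = y^j≉ε 3 (s≤s z≤n) (s≤s (s≤s (s≤s (s≤s z≤n)))) (begin
      y ^ 3          ≈⟨ ^-congˡ (trans (inverseˡ-unique y x yx≈ε) (sym x²≈x⁻¹)) 3 ⟩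
      (x ^ 2) ^ 3    ≈⟨ ^-assoc x 2 3 ⟩
      x ^ 6          ≈⟨ ^-*-ε {n = 3} x³≈ε 2 ⟩
      ε              ∎)

    xxy≉ε : ¬ (x ∙ (x ∙ y) ≈ ε)
    xxy≉ε xxy≈ε = y≉x (trans y≈xε (identityʳ x))
      where
      y≈xε : y ≈ x ∙ ε
      y≈xε = ∙-cancelˡ x y (x ∙ ε)
        (trans (inverseʳ-unique x (x ∙ y) xxy≈ε) (sym x²≈x⁻¹))

    x∙y²≈ε⇒exceptional : GeneratedBy x y → x ∙ (y ∙ y) ≈ ε →
                         HasOrder y 6 × x ≈ y ^ 4 × IsoZ6
    x∙y²≈ε⇒exceptional gen xyy≈ε = ord-y₆ , sym y⁴≈x , cyclic≅Fin ord-y₆ powers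
      where
      y²≈x² : y ^ 2 ≈ x ^ 2
      y²≈x² = begin
        y ^ 2      ≈⟨ ∙-congˡ (identityʳ y) ⟩
        y ∙ y      ≈⟨ inverseʳ-unique x (y ∙ y) xyy≈ε ⟩
        x ⁻¹       ≈⟨ x²≈x⁻¹ ⟨
        x ^ 2      ∎

      y⁴≈x : y ^ 4 ≈ x
      y⁴≈x = begin
        y ^ 4             ≈⟨ ^-homo-+ y 2 2 ⟩
        y ^ 2 ∙ y ^ 2     ≈⟨ ∙-cong y²≈x² y²≈x² ⟩
        x ^ 2 ∙ x ^ 2     ≈⟨ ^-homo-+ x 2 2 ⟨
        x ^ 4             ≈⟨ ^-homo-+ x 3 1 ⟩
        x ^ 3 ∙ x ^ 1     ≈⟨ ∙-congʳ x³≈ε ⟩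
        ε ∙ x ^ 1         ≈⟨ identityˡ _ ⟩
        x ∙ ε             ≈⟨ identityʳ x ⟩
        x                 ∎

      y⁶≈ε : y ^ 6 ≈ ε
      y⁶≈ε = begin
        y ^ 6           ≈⟨ ^-homo-+ y 4 2 ⟩
        y ^ 4 ∙ y ^ 2   ≈⟨ ∙-cong y⁴≈x y²≈x² ⟩
        x ^ 3           ≈⟨ x³≈ε ⟩
        ε               ∎

      ord-y₆ : HasOrder y 6
      ord-y₆ = ≡.subst (HasOrder y) (∣6⇒≡6 k≥4 (order-divides ord-y y⁶≈ε)) ord-y

      powers : ∀ h → ∃ λ i → h ≈ y ^ i
      powers h with gen h
      ... | w , w≈h with eval-power {m = 5} {a = 4} {b = 1} y⁶≈ε (sym y⁴≈x) (sym (identityʳ y)) w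
      ... | i , w≈yⁱ = i , trans (sym w≈h) w≈yⁱ

  module RegularRepresentation (x y : Carrier) {k : ℕ}
                     (ord-x : HasOrder x 3) (ord-y : HasOrder y k) (k≥4 : k ≥ 4)
                     (xyy≉ε : ¬ (x ∙ (y ∙ y) ≈ ε)) where
    open Generators x y ord-x ord-y k≥4
    open CayleyPair x y

    proper : IsProper S
    proper u v uv vu with arc-cases uv | arc-cases vu
    ... | inj₁ v≈xu | inj₁ u≈xv = xx≉ε (relation-of-2-cycle v≈xu u≈xv)
    ... | inj₁ v≈xu | inj₂ u≈yv = yx≉ε (relation-of-2-cycle v≈xu u≈yv)
    ... | inj₂ v≈yu | inj₁ u≈xv = yx≉ε (∙≈ε-comm (relation-of-2-cycle v≈yu u≈xv))
    ... | inj₂ v≈yu | inj₂ u≈yv = yy≉ε (relation-of-2-cycle v≈yu u≈yv)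

    y-arc-not-on-triangle : ∀ {u v w} → v ≈ y ∙ u → Arc S v w → Arc S w u → ⊥
    y-arc-not-on-triangle v≈yu vw wu with arc-cases vw | arc-cases wu
    ... | inj₁ w≈xv | inj₁ u≈xw = xxy≉ε (relation-of-3-cycle v≈yu w≈xv u≈xw)
    ... | inj₁ w≈xv | inj₂ u≈yw =
      xyy≉ε (trans (sym (assoc _ _ _)) (∙≈ε-comm (relation-of-3-cycle v≈yu w≈xv u≈yw)))
    ... | inj₂ w≈yv | inj₁ u≈xw = xyy≉ε (relation-of-3-cycle v≈yu w≈yv u≈xw)
    ... | inj₂ w≈yv | inj₂ u≈yw = yyy≉ε (relation-of-3-cycle v≈yu w≈yv u≈yw)

    apply : Automorphism S → Carrier → Carrier
    apply σ = Inverse.to (proj₁ σ)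

    apply-Arc : ∀ σ {u v} → Arc S u v → Arc S (apply σ u) (apply σ v)
    apply-Arc σ = proj₁ (proj₂ σ _ _)

    preserves-x-arcs : ∀ σ u → apply σ (x ∙ u) ≈ x ∙ apply σ u
    preserves-x-arcs σ u with arc-cases (apply-Arc σ (x-arc u))
    ... | inj₁ fxu≈xfu = fxu≈xfu
    ... | inj₂ fxu≈yfu = ⊥-elim (y-arc-not-on-triangle fxu≈yfu
            (apply-Arc σ (x-arc (x ∙ u)))
            (apply-Arc σ (Arc-resp S-resp refl (x∙[x∙[x∙u]]≈u u) (x-arc (x ∙ (x ∙ u))))))

    -- σ⁻¹ maps x-arcs to x-arcs, so σ cannot map a y-arc to an x-arc.
    preserves-y-arcs : ∀ σ u → apply σ (y ∙ u) ≈ y ∙ apply σ u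
    preserves-y-arcs σ u with arc-cases (apply-Arc σ (y-arc u))
    ... | inj₂ fyu≈yfu = fyu≈yfu
    ... | inj₁ fyu≈xfu = ⊥-elim (y≉x (∙-cancelʳ u y x (begin
      y ∙ u                         ≈⟨ Inverse.strictlyInverseʳ (proj₁ σ) (y ∙ u) ⟨
      apply σ⁻¹ (apply σ (y ∙ u))   ≈⟨ Inverse.from-cong (proj₁ σ) fyu≈xfu ⟩
      apply σ⁻¹ (x ∙ apply σ u)     ≈⟨ preserves-x-arcs σ⁻¹ (apply σ u) ⟩
      x ∙ apply σ⁻¹ (apply σ u)     ≈⟨ ∙-congˡ (Inverse.strictlyInverseʳ (proj₁ σ) u) ⟩
      x ∙ u                         ∎)))
      where
      σ⁻¹ : Automorphism S
      σ⁻¹ = Automorphism-sym S-resp σ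

    isDRR : GeneratedBy x y → IsDRR S
    isDRR gen σ = apply σ ε , equivariant⇒translation gen (apply σ) (Inverse.to-cong (proj₁ σ))
                                (preserves-x-arcs σ) (preserves-y-arcs σ)

lemma2p4 : {c ℓ : Level} (G : Group c ℓ) → GroupDefs.Finite G →
    (x y : Group.Carrier G) → GroupDefs.GeneratedBy G x y →
    GroupDefs.HasOrder G x 3 →
    (∃ λ k → (k ≥ 4) × GroupDefs.HasOrder G y k) →
    ¬ (GroupDefs.HasOrder G y 6 × Group._≈_ G x (GroupDefs._^_ G y 4) × GroupDefs.IsoZ6 G) →
    GroupDefs.IsORR G (GroupDefs.Pair G x y)
lemma2p4 G _ x y gen ord-x (k , k≥4 , ord-y) not-exceptional =
  isDRR gen , proper
  where
  open GroupLemmas G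
  open RegularRepresentation x y ord-x ord-y k≥4
         (not-exceptional ∘ Generators.x∙y²≈ε⇒exceptional x y ord-x ord-y k≥4 gen)
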